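{- Let $D$ be the derivation of $\mathbb{Q}[W,X,Y,Z]$ with $D(W)=WX$, $D(X)=YZ$, $D(Y)=XZ$, $D(Z)=XY$, and define integers $t_{n,i,j}$ by $$D^{2n}(W)=W\sum_{i,j\ge0}t_{2n,i,j}X^{2i}Y^jZ^{2n-2i-j},\qquad D^{2n+1}(W)=W\sum_{i,j\ge0}t_{2n+1,i,j}X^{2i+1}Y^jZ^{2n-2i-j}.$$ Let $T(x,p,q)=\sum_{n,i,j}t_{n,i,j}\frac{x^n}{n!}p^iq^j$ with even part $TE=\frac12(T(x,p,q)+T(-x,p,q))$ and odd part $TO=\frac12(T(x,p,q)-T(-x,p,q))$ in $x$. Then $$TO_x=TE+2q(1-p)TE_p+(1-q^2)TE_q+xqTE_x,\qquad TE_x=(p+q-qp)TO+2pq(1-p)TO_p+p(1-q^2)TO_q+xqpTO_x.$$ Equivalently, $(TO',TE')$ with $TO'=\sqrt{\frac{p(1+q)}{1-q}}\,TO$ and $TE'=\sqrt{\frac{1+q}{1-q}}\,TE$ is a $J$-pair of the second type.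
   Context: Subscripts denote partial derivatives. A pair $(\widetilde F,\widetilde G)$ of functions of $(x,p,q)$ is a $J$-pair of the second type if $\widetilde F_x=2q\sqrt p(1-p)\widetilde G_p+\sqrt p(1-q^2)\widetilde G_q+xq\sqrt p\,\widetilde G_x$ and $\widetilde G_x=2q\sqrt p(1-p)\widetilde F_p+\sqrt p(1-q^2)\widetilde F_q+xq\sqrt p\,\widetilde F_x$. -}

module Defs where

open import Data.Nat as ℕ using (ℕ; zero; suc; _!; _≤?_)
open import Data.Nat.Properties using (_!≢0)
open import Data.Integer as ℤ using (ℤ; +_)
open import Data.Rational as ℚ using (ℚ; _/_; ½)
open import Relation.Nullary using (yes; no)
open import Relation.Binary.PropositionalEquality using (_≡_)

-- Polynomials (indeed formal series) in W,X,Y,Z over ℤ ⊆ ℚ, represented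
-- by their coefficient function: c w a b d = coefficient of W^w X^a Y^b Z^d.

Poly4 : Set
Poly4 = ℕ → ℕ → ℕ → ℕ → ℤ

-- On a monomial:  D(W^w X^a Y^b Z^d) =
--    w W^w X^(a+1) Y^b Z^d + a W^w X^(a-1) Y^(b+1) Z^(d+1)
--  + b W^w X^(a+1) Y^(b-1) Z^(d+1) + d W^w X^(a+1) Y^(b+1) Z^(d-1).
D : Poly4 → Poly4
D f w a b d = termW a b d ℤ.+ termX a b d ℤ.+ termY a b d ℤ.+ termZ a b d
  where
  termW : ℕ → ℕ → ℕ → ℤ
  termW zero    b d = + 0
  termW (suc a) b d = + w ℤ.* f w a b d
  termX : ℕ → ℕ → ℕ → ℤ
  termX a (suc b) (suc d) = + suc a ℤ.* f w (suc a) b d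
  termX a _ _ = + 0
  termY : ℕ → ℕ → ℕ → ℤ
  termY (suc a) b (suc d) = + suc b ℤ.* f w a (suc b) d
  termY _ _ _ = + 0
  termZ : ℕ → ℕ → ℕ → ℤ
  termZ (suc a) (suc b) d = + suc d ℤ.* f w a b (suc d)
  termZ _ _ _ = + 0

Wpoly : Poly4
Wpoly 1 0 0 0 = + 1
Wpoly _ _ _ _ = + 0

Dpow : ℕ → Poly4 → Poly4
Dpow zero    f = f
Dpow (suc n) f = D (Dpow n f)

-- t n i j : coefficient of W X^(2i + (n mod 2)) Y^j Z^(n - 2i - (n mod 2) - j)
-- in D^n(W)  (zero when the Z-exponent would be negative).
t : ℕ → ℕ → ℕ → ℤ
t n i j with (2 ℕ.* i ℕ.+ n ℕ.% 2 ℕ.+ j) ≤? n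
... | yes _ = Dpow n Wpoly 1 (2 ℕ.* i ℕ.+ n ℕ.% 2) j (n ℕ.∸ (2 ℕ.* i ℕ.+ n ℕ.% 2 ℕ.+ j))
... | no  _ = + 0

-- Formal power series in x, p, q over ℚ: F n i j = coefficient of x^n p^i q^j.

FPS3 : Set
FPS3 = ℕ → ℕ → ℕ → ℚ

T : FPS3
T n i j = (t n i j / (n !)) {{n !≢0}}

_⊕_ : FPS3 → FPS3 → FPS3
(F ⊕ G) n i j = F n i j ℚ.+ G n i j
infixl 6 _⊕_ _⊖_

_⊖_ : FPS3 → FPS3 → FPS3
(F ⊖ G) n i j = F n i j ℚ.- G n i j

_·_ : ℚ → FPS3 → FPS3
(c · F) n i j = c ℚ.* F n i j
infixr 7 _·_

mulx : FPS3 → FPS3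
mulx F zero    i j = ℚ.0ℚ
mulx F (suc n) i j = F n i j

mulp : FPS3 → FPS3
mulp F n zero    j = ℚ.0ℚ
mulp F n (suc i) j = F n i j

mulq : FPS3 → FPS3
mulq F n i zero    = ℚ.0ℚ
mulq F n i (suc j) = F n i j

∂x : FPS3 → FPS3
∂x F n i j = (+ suc n / 1) ℚ.* F (suc n) i j

∂p : FPS3 → FPS3
∂p F n i j = (+ suc i / 1) ℚ.* F n (suc i) j

∂q : FPS3 → FPS3
∂q F n i j = (+ suc j / 1) ℚ.* F n i (suc j)

negx : FPS3 → FPS3
negx F n i j = (ℤ.-1ℤ ℤ.^ n / 1) ℚ.* F n i j

TE : FPS3
TE = ½ · (T ⊕ negx T)

TO : FPS3
TO = ½ · (T ⊖ negx T)

_≐_ : FPS3 → FPS3 → Set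
F ≐ G = ∀ n i j → F n i j ≡ G n i j
infix 4 _≐_

module Submission where

-- Every series here is  egf f = Σ f(n,i,j) x^n/n! p^i q^j  for an integer array f, and each
-- operation of the statement acts on f by an integer operation (∂x shifts n, multiplication by x
-- gives n·f(n-1)); so both identities become identities of integer arrays.  Let c(n,a,b) be the
-- coefficient of W X^a Y^b Z^(n-a-b) in D^n(W); by homogeneity there are no others, and D gives
--   c(n+1,a+1,b+1) = c(n,a,b+1) + (a+2) c(n,a+2,b) + (b+2) c(n,a,b+2) + (n-a-b) c(n,a,b)
-- with boundary versions for a = 0 or b = 0.  At even n, t(n,i,j) = c(n,2i,j) and the odd part
-- vanishes; at odd n, t(n,i,j) = c(n,2i+1,j) and the even part vanishes.  Setting a = 2i or 2i+1
-- yields exactly the coefficients of the two right-hand sides.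

open import Defs
open import Data.Rational using (ℚ; _/_)
open import Data.Integer using (+_)
open import Data.Product using (_×_)

open import Data.Product using (_,_)
open import Data.Sum using (_⊎_; inj₁; inj₂)
open import Data.List using (_∷_; [])
open import Data.Nat as ℕ using (ℕ; zero; suc; _!; _<_; _≤?_; s≤s)
open import Data.Nat.Properties using (_!≢0)
import Data.Nat.Properties as ℕP
open import Data.Nat.Tactic.RingSolver using () renaming (solve to solveℕ)
open import Data.Integer as ℤ using (ℤ)
import Data.Integer.Properties as ℤP
open import Data.Integer.Tactic.RingSolver using (solve)
open import Data.Rational as ℚ using (½; fromℚᵘ; toℚᵘ)
import Data.Rational.Properties as ℚP
open import Data.Rational.Unnormalised as ℚᵘ using (mkℚᵘ; _≃_)
import Data.Rational.Unnormalised.Properties as ℚᵘP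
open import Relation.Nullary using (yes; no; contradiction)
open import Relation.Binary.PropositionalEquality

fromℚᵘ-sound : ∀ {r p} → toℚᵘ r ≃ p → r ≡ fromℚᵘ p
fromℚᵘ-sound {r} e = trans (sym (ℚP.fromℚᵘ-toℚᵘ r)) (ℚP.fromℚᵘ-cong e)

fromℚᵘ-+ : ∀ p q → fromℚᵘ p ℚ.+ fromℚᵘ q ≡ fromℚᵘ (p ℚᵘ.+ q)
fromℚᵘ-+ p q = fromℚᵘ-sound (ℚᵘP.≃-trans (ℚP.toℚᵘ-homo-+ (fromℚᵘ p) (fromℚᵘ q))
  (ℚᵘP.+-cong (ℚP.toℚᵘ-fromℚᵘ p) (ℚP.toℚᵘ-fromℚᵘ q)))

fromℚᵘ-* : ∀ p q → fromℚᵘ p ℚ.* fromℚᵘ q ≡ fromℚᵘ (p ℚᵘ.* q)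
fromℚᵘ-* p q = fromℚᵘ-sound (ℚᵘP.≃-trans (ℚP.toℚᵘ-homo-* (fromℚᵘ p) (fromℚᵘ q))
  (ℚᵘP.*-cong (ℚP.toℚᵘ-fromℚᵘ p) (ℚP.toℚᵘ-fromℚᵘ q)))

fromℚᵘ-neg : ∀ p → ℚ.- fromℚᵘ p ≡ fromℚᵘ (ℚᵘ.- p)
fromℚᵘ-neg p = fromℚᵘ-sound (ℚᵘP.≃-trans (ℚP.toℚᵘ-homo‿- (fromℚᵘ p))
  (ℚᵘP.-‿cong (ℚP.toℚᵘ-fromℚᵘ p)))

frac-+ : ∀ a b k .{{_ : ℕ.NonZero k}} → a / k ℚ.+ b / k ≡ (a ℤ.+ b) / k
frac-+ a b (suc k) = trans (fromℚᵘ-+ (mkℚᵘ a k) (mkℚᵘ b k)) (ℚP.fromℚᵘ-cong common)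
  where
  common : mkℚᵘ a k ℚᵘ.+ mkℚᵘ b k ≃ mkℚᵘ (a ℤ.+ b) k
  common rewrite sym (ℤP.*-distribʳ-+ (+ suc k) a b) = ℚᵘP.*-cancelʳ-/ (suc k)

frac-neg : ∀ a k .{{_ : ℕ.NonZero k}} → ℚ.- (a / k) ≡ (ℤ.- a) / k
frac-neg a (suc k) = fromℚᵘ-neg (mkℚᵘ a k)

frac-- : ∀ a b k .{{_ : ℕ.NonZero k}} → a / k ℚ.- b / k ≡ (a ℤ.- b) / k
frac-- a b k = trans (cong (a / k ℚ.+_) (frac-neg b k)) (frac-+ a (ℤ.- b) k)

frac-scale : ∀ c a k .{{_ : ℕ.NonZero k}} → (c / 1) ℚ.* (a / k) ≡ (c ℤ.* a) / k
frac-scale c a (suc k) = trans (fromℚᵘ-* (mkℚᵘ c 0) (mkℚᵘ a k))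
  (cong (λ d → fromℚᵘ (mkℚᵘ (c ℤ.* a) d)) (ℕP.+-identityʳ k))

frac-cancel : ∀ m a k .{{_ : ℕ.NonZero m}} .{{_ : ℕ.NonZero k}} →
              ((+ m ℤ.* a) / (m ℕ.* k)) {{ℕP.m*n≢0 m k}} ≡ a / k
frac-cancel (suc m) a (suc k) = ℚP.fromℚᵘ-cong (ℚᵘP.*-cancelˡ-/ (suc m) {a})

frac-zero : ∀ k .{{_ : ℕ.NonZero k}} → ℚ.0ℚ ≡ + 0 / k
frac-zero k = sym (ℚP.0/n≡0 k)

frac-half : ∀ a k .{{_ : ℕ.NonZero k}} → ½ ℚ.* ((+ 2 ℤ.* a) / k) ≡ a / k
frac-half a k = begin
  ½ ℚ.* ((+ 2 ℤ.* a) / k)          ≡⟨ cong (½ ℚ.*_) (frac-scale (+ 2) a k) ⟨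
  ½ ℚ.* ((+ 2 / 1) ℚ.* (a / k))    ≡⟨ ℚP.*-assoc ½ (+ 2 / 1) (a / k) ⟨
  (½ ℚ.* (+ 2 / 1)) ℚ.* (a / k)    ≡⟨ ℚP.*-identityˡ (a / k) ⟩
  a / k                            ∎
  where open ≡-Reasoning

-- Integer coefficient arrays, indexed like FPS3, and the integer counterparts of the operations
-- on series.  In exponential coefficients ∂x is a shift and multiplication by x is  n · f(n-1).

Coeffs : Set
Coeffs = ℕ → ℕ → ℕ → ℤ

_⊕ᶻ_ _⊖ᶻ_ : Coeffs → Coeffs → Coeffs
(f ⊕ᶻ g) n i j = f n i j ℤ.+ g n i j
(f ⊖ᶻ g) n i j = f n i j ℤ.- g n i j
infixl 6 _⊕ᶻ_ _⊖ᶻ_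

_·ᶻ_ : ℤ → Coeffs → Coeffs
(c ·ᶻ f) n i j = c ℤ.* f n i j
infixr 7 _·ᶻ_

mulpᶻ mulqᶻ ∂pᶻ ∂qᶻ mulxᶻ ∂xᶻ negxᶻ : Coeffs → Coeffs
mulpᶻ f n zero    j = + 0
mulpᶻ f n (suc i) j = f n i j
mulqᶻ f n i zero    = + 0
mulqᶻ f n i (suc j) = f n i j
∂pᶻ f n i j = + suc i ℤ.* f n (suc i) j
∂qᶻ f n i j = + suc j ℤ.* f n i (suc j)
mulxᶻ f n i j = + n ℤ.* f (ℕ.pred n) i j
∂xᶻ f n i j = f (suc n) i j
negxᶻ f n i j = (ℤ.-1ℤ ℤ.^ n) ℤ.* f n i j

-- The transfer: egf f is the series with coefficients f(n,i,j)/n!, and each operation on series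
-- corresponds to its integer counterpart.  (egf is opaque so that f can be read off from egf f.)
opaque
  egf : Coeffs → FPS3
  egf f n i j = (f n i j / n !) {{n !≢0}}

  egf-T : T ≐ egf t
  egf-T n i j = refl

  egf-cong : ∀ {f g : Coeffs} → (∀ n i j → f n i j ≡ g n i j) → egf f ≐ egf g
  egf-cong f≡g n i j = cong (λ z → (z / n !) {{n !≢0}}) (f≡g n i j)

  egf-⊕ : ∀ {F G f g} → F ≐ egf f → G ≐ egf g → F ⊕ G ≐ egf (f ⊕ᶻ g)
  egf-⊕ {f = f} {g} hF hG n i j =
    trans (cong₂ ℚ._+_ (hF n i j) (hG n i j)) (frac-+ (f n i j) (g n i j) (n !) {{n !≢0}})

  egf-⊖ : ∀ {F G f g} → F ≐ egf f → G ≐ egf g → F ⊖ G ≐ egf (f ⊖ᶻ g)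
  egf-⊖ {f = f} {g} hF hG n i j =
    trans (cong₂ ℚ._-_ (hF n i j) (hG n i j)) (frac-- (f n i j) (g n i j) (n !) {{n !≢0}})

  egf-· : ∀ {F f} c → F ≐ egf f → (c / 1) · F ≐ egf (c ·ᶻ f)
  egf-· {f = f} c hF n i j =
    trans (cong ((c / 1) ℚ.*_) (hF n i j)) (frac-scale c (f n i j) (n !) {{n !≢0}})

  egf-negx : ∀ {F f} → F ≐ egf f → negx F ≐ egf (negxᶻ f)
  egf-negx {f = f} hF n i j = egf-· {f = f} (ℤ.-1ℤ ℤ.^ n) hF n i j

  egf-mulp : ∀ {F f} → F ≐ egf f → mulp F ≐ egf (mulpᶻ f)
  egf-mulp hF n zero    j = frac-zero (n !) {{n !≢0}}
  egf-mulp hF n (suc i) j = hF n i j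

  egf-mulq : ∀ {F f} → F ≐ egf f → mulq F ≐ egf (mulqᶻ f)
  egf-mulq hF n i zero    = frac-zero (n !) {{n !≢0}}
  egf-mulq hF n i (suc j) = hF n i j

  egf-∂p : ∀ {F f} → F ≐ egf f → ∂p F ≐ egf (∂pᶻ f)
  egf-∂p {f = f} hF n i j = egf-· {f = f} (+ suc i) hF n (suc i) j

  egf-∂q : ∀ {F f} → F ≐ egf f → ∂q F ≐ egf (∂qᶻ f)
  egf-∂q {f = f} hF n i j = egf-· {f = f} (+ suc j) hF n i (suc j)

  -- x^n/n! · x = (n+1) · x^(n+1)/(n+1)!
  egf-mulx : ∀ {F f} → F ≐ egf f → mulx F ≐ egf (mulxᶻ f)
  egf-mulx hF zero    i j = refl
  egf-mulx {f = f} hF (suc n) i j =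
    trans (hF n i j) (sym (frac-cancel (suc n) (f n i j) (n !) {{_}} {{n !≢0}}))

  -- ∂x (x^(n+1)/(n+1)!) = x^n/n!
  egf-∂x : ∀ {F f} → F ≐ egf f → ∂x F ≐ egf (∂xᶻ f)
  egf-∂x {f = f} hF n i j =
    trans (egf-· {f = f} (+ suc n) hF (suc n) i j)
          (frac-cancel (suc n) (f (suc n) i j) (n !) {{_}} {{n !≢0}})

  egf-half : ∀ {F f g} → F ≐ egf f → (∀ n i j → f n i j ≡ + 2 ℤ.* g n i j) → ½ · F ≐ egf g
  egf-half {g = g} hF f≡2g n i j =
    trans (cong (½ ℚ.*_) (trans (hF n i j) (cong (λ z → (z / n !) {{n !≢0}}) (f≡2g n i j))))
          (frac-half (g n i j) (n !) {{n !≢0}})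

-- Even and odd parts.  evenPart n x keeps x exactly when n is even; since T(-x) has coefficients
-- (-1)^n t, the integer coefficients of TE and TO are te and to below.

evenPart : ℕ → ℤ → ℤ
evenPart zero          x = x
evenPart (suc zero)    x = + 0
evenPart (suc (suc n)) x = evenPart n x

oddPart : ℕ → ℤ → ℤ
oddPart n = evenPart (suc n)

te to : Coeffs
te n i j = evenPart n (t n i j)
to n i j = oddPart n (t n i j)

sign-period : ∀ n → ℤ.-1ℤ ℤ.^ suc (suc n) ≡ ℤ.-1ℤ ℤ.^ n
sign-period n = lemma (ℤ.-1ℤ ℤ.^ n)
  where
  lemma : ∀ s → ℤ.-1ℤ ℤ.* (ℤ.-1ℤ ℤ.* s) ≡ s
  lemma s = solve (s ∷ [])

even-sum : ∀ n x → x ℤ.+ (ℤ.-1ℤ ℤ.^ n) ℤ.* x ≡ + 2 ℤ.* evenPart n x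
even-sum zero          x = lemma x
  where
  lemma : ∀ x → x ℤ.+ + 1 ℤ.* x ≡ + 2 ℤ.* x
  lemma x = solve (x ∷ [])
even-sum (suc zero)    x = lemma x
  where
  lemma : ∀ x → x ℤ.+ ℤ.-1ℤ ℤ.* x ≡ + 2 ℤ.* + 0
  lemma x = solve (x ∷ [])
even-sum (suc (suc n)) x = trans (cong (λ s → x ℤ.+ s ℤ.* x) (sign-period n)) (even-sum n x)

odd-diff : ∀ n x → x ℤ.- (ℤ.-1ℤ ℤ.^ n) ℤ.* x ≡ + 2 ℤ.* oddPart n x
odd-diff zero          x = lemma x
  where
  lemma : ∀ x → x ℤ.- + 1 ℤ.* x ≡ + 2 ℤ.* + 0
  lemma x = solve (x ∷ [])
odd-diff (suc zero)    x = lemma x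
  where
  lemma : ∀ x → x ℤ.- ℤ.-1ℤ ℤ.* x ≡ + 2 ℤ.* x
  lemma x = solve (x ∷ [])
odd-diff (suc (suc n)) x = trans (cong (λ s → x ℤ.- s ℤ.* x) (sign-period n)) (odd-diff n x)

TE-egf : TE ≐ egf te
TE-egf = egf-half (egf-⊕ egf-T (egf-negx egf-T)) (λ n i j → even-sum n (t n i j))

TO-egf : TO ≐ egf to
TO-egf = egf-half (egf-⊖ egf-T (egf-negx egf-T)) (λ n i j → odd-diff n (t n i j))

-- What the proof uses about an even level n.  A level is odd exactly when its successor is even,
-- and EvenLevel (n + 2) unfolds to the same facts as EvenLevel n.
record EvenLevel (n : ℕ) : Set where
  field
    residue     : n ℕ.% 2 ≡ 0
    residue-suc : suc n ℕ.% 2 ≡ 1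
    keeps       : ∀ x → evenPart n x ≡ x
    kills       : ∀ x → oddPart n x ≡ + 0
open EvenLevel

parity : ∀ n → EvenLevel n ⊎ EvenLevel (suc n)
parity zero = inj₁ record { residue = refl ; residue-suc = refl ; keeps = λ _ → refl ; kills = λ _ → refl }
parity (suc n) with parity n
... | inj₁ ev = inj₂ record { residue = residue ev ; residue-suc = residue-suc ev
                            ; keeps = keeps ev ; kills = kills ev }
... | inj₂ od = inj₁ od

opaque
  coeff : ℕ → ℕ → ℕ → ℕ → ℤ
  coeff n = Dpow n Wpoly 1

zero-sum : ∀ {p q r s : ℤ} → p ≡ + 0 → q ≡ + 0 → r ≡ + 0 → s ≡ + 0 → p ℤ.+ q ℤ.+ r ℤ.+ s ≡ + 0
zero-sum refl refl refl refl = refl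

module _ {f : Poly4} {m : ℕ} (hf : ∀ a b d → a ℕ.+ b ℕ.+ d ≢ m → f 1 a b d ≡ + 0) where

  vanish : ∀ {S} → S ≢ suc m → ∀ k a b d → suc (a ℕ.+ b ℕ.+ d) ≡ S → + k ℤ.* f 1 a b d ≡ + 0
  vanish ne k a b d eq =
    trans (cong (+ k ℤ.*_) (hf a b d (λ e → ne (trans (sym eq) (cong suc e))))) (ℤP.*-zeroʳ (+ k))

  D-homogeneous : ∀ a b d → a ℕ.+ b ℕ.+ d ≢ suc m → D f 1 a b d ≡ + 0
  D-homogeneous zero    zero    zero    ne = refl
  D-homogeneous zero    zero    (suc d) ne = refl
  D-homogeneous zero    (suc b) zero    ne = refl
  D-homogeneous zero    (suc b) (suc d) ne =
    zero-sum refl (vanish ne 1 1 b d (solveℕ (b ∷ d ∷ []))) refl refl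
  D-homogeneous (suc a) zero    zero    ne =
    zero-sum (vanish ne 1 a 0 0 (solveℕ (a ∷ []))) refl refl refl
  D-homogeneous (suc a) zero    (suc d) ne =
    zero-sum (vanish ne 1 a 0 (suc d) (solveℕ (a ∷ d ∷ []))) refl
             (vanish ne 1 a 1 d (solveℕ (a ∷ d ∷ []))) refl
  D-homogeneous (suc a) (suc b) zero    ne =
    zero-sum (vanish ne 1 a (suc b) 0 (solveℕ (a ∷ b ∷ []))) refl refl
             (vanish ne 1 a b 1 (solveℕ (a ∷ b ∷ [])))
  D-homogeneous (suc a) (suc b) (suc d) ne =
    zero-sum (vanish ne 1 a (suc b) (suc d) (solveℕ (a ∷ b ∷ d ∷ [])))
             (vanish ne (suc (suc a)) (suc (suc a)) b d (solveℕ (a ∷ b ∷ d ∷ [])))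
             (vanish ne (suc (suc b)) a (suc (suc b)) d (solveℕ (a ∷ b ∷ d ∷ [])))
             (vanish ne (suc (suc d)) a b (suc (suc d)) (solveℕ (a ∷ b ∷ d ∷ [])))

-- The right-hand side of the main recurrence: the coefficient of X^(a+1) Y^(b+1) at the next
-- level collects X^a Y^(b+1) (from W ↦ WX), X^(a+2) Y^b (from X ↦ YZ), X^a Y^(b+2) (from Y ↦ XZ)
-- and X^a Y^b (from Z ↦ XY, weighted by its Z-exponent z).
recurrence : ℕ → ℕ → ℤ → ℤ → ℤ → ℤ → ℤ → ℤ
recurrence a b u v w z x = u ℤ.+ + (2 ℕ.+ a) ℤ.* v ℤ.+ + (2 ℕ.+ b) ℤ.* w ℤ.+ z ℤ.* x

recurrence-cong : ∀ a b {u u' v v' w w' z z' x x'} →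
                  u ≡ u' → v ≡ v' → w ≡ w' → z ≡ z' → x ≡ x' →
                  recurrence a b u v w z x ≡ recurrence a b u' v' w' z' x'
recurrence-cong a b refl refl refl refl refl = refl

recurrence-last : ∀ a b z x → recurrence a b (+ 0) (+ 0) (+ 0) z x ≡ z ℤ.* x
recurrence-last a b z x = lemma (+ (2 ℕ.+ a)) (+ (2 ℕ.+ b)) (z ℤ.* x)
  where
  lemma : ∀ k l y → + 0 ℤ.+ k ℤ.* + 0 ℤ.+ l ℤ.* + 0 ℤ.+ y ≡ y
  lemma k l y = solve (k ∷ l ∷ y ∷ [])

recurrence-ends : ∀ a b u x → recurrence a b u (+ 0) (+ 0) (+ 1) x ≡ u ℤ.+ x
recurrence-ends a b u x = lemma (+ (2 ℕ.+ a)) (+ (2 ℕ.+ b)) u x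
  where
  lemma : ∀ k l u x → u ℤ.+ k ℤ.* + 0 ℤ.+ l ℤ.* + 0 ℤ.+ + 1 ℤ.* x ≡ u ℤ.+ x
  lemma k l u x = solve (k ∷ l ∷ u ∷ x ∷ [])

opaque
  unfolding coeff

  homogeneous : ∀ n a b d → a ℕ.+ b ℕ.+ d ≢ n → coeff n a b d ≡ + 0
  homogeneous zero    zero    zero    zero    ne = contradiction refl ne
  homogeneous zero    (suc a) b       d       ne = refl
  homogeneous zero    zero    (suc b) d       ne = refl
  homogeneous zero    zero    zero    (suc d) ne = refl
  homogeneous (suc n) = D-homogeneous (homogeneous n)

  D-00 : ∀ n d → coeff (suc n) 0 0 d ≡ + 0
  D-00 n zero    = refl
  D-00 n (suc d) = refl

  D-0b0 : ∀ n b → coeff (suc n) 0 (suc b) 0 ≡ + 0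
  D-0b0 n b = refl

  D-0b : ∀ n b d → coeff (suc n) 0 (suc b) (suc d) ≡ coeff n 1 b d
  D-0b n b d = lemma (coeff n 1 b d)
    where
    lemma : ∀ x → + 0 ℤ.+ + 1 ℤ.* x ℤ.+ + 0 ℤ.+ + 0 ≡ x
    lemma x = solve (x ∷ [])

  D-a00 : ∀ n a → coeff (suc n) (suc a) 0 0 ≡ coeff n a 0 0
  D-a00 n a = lemma (coeff n a 0 0)
    where
    lemma : ∀ x → + 1 ℤ.* x ℤ.+ + 0 ℤ.+ + 0 ℤ.+ + 0 ≡ x
    lemma x = solve (x ∷ [])

  D-a0 : ∀ n a d → coeff (suc n) (suc a) 0 (suc d) ≡ coeff n a 0 (suc d) ℤ.+ coeff n a 1 d
  D-a0 n a d = lemma (coeff n a 0 (suc d)) (coeff n a 1 d)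
    where
    lemma : ∀ x y → + 1 ℤ.* x ℤ.+ + 0 ℤ.+ + 1 ℤ.* y ℤ.+ + 0 ≡ x ℤ.+ y
    lemma x y = solve (x ∷ y ∷ [])

  D-ab0 : ∀ n a b → coeff (suc n) (suc a) (suc b) 0 ≡ coeff n a (suc b) 0 ℤ.+ coeff n a b 1
  D-ab0 n a b = lemma (coeff n a (suc b) 0) (coeff n a b 1)
    where
    lemma : ∀ x y → + 1 ℤ.* x ℤ.+ + 0 ℤ.+ + 0 ℤ.+ + 1 ℤ.* y ≡ x ℤ.+ y
    lemma x y = solve (x ∷ y ∷ [])

  D-ab : ∀ n a b d → coeff (suc n) (suc a) (suc b) (suc d) ≡
         recurrence a b (coeff n a (suc b) (suc d)) (coeff n (2 ℕ.+ a) b d) (coeff n a (2 ℕ.+ b) d)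
                        (+ (2 ℕ.+ d)) (coeff n a b (2 ℕ.+ d))
  D-ab n a b d = cong (λ u → recurrence a b u (coeff n (2 ℕ.+ a) b d) (coeff n a (2 ℕ.+ b) d)
                                          (+ (2 ℕ.+ d)) (coeff n a b (2 ℕ.+ d)))
                      (ℤP.*-identityˡ (coeff n a (suc b) (suc d)))

-- c n a b: the coefficient of W X^a Y^b Z^(n-a-b) in D^n(W).  By homogeneity it determines all
-- coefficients, and it vanishes when a + b > n.
opaque
  c : ℕ → ℕ → ℕ → ℤ
  c n a b = coeff n a b (n ℕ.∸ (a ℕ.+ b))

  c-at : ∀ {n} a b d → a ℕ.+ b ℕ.+ d ≡ n → c n a b ≡ coeff n a b d
  c-at a b d refl = cong (coeff _ a b) (ℕP.m+n∸m≡n (a ℕ.+ b) d)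

  c-00 : ∀ n → c (suc n) 0 0 ≡ + 0
  c-00 n = D-00 n (suc n)

  c-beyond : ∀ {n} a b → n < a ℕ.+ b → c n a b ≡ + 0
  c-beyond {n} a b n<ab = homogeneous n a b _ λ eq →
    ℕP.<⇒≱ n<ab (subst (a ℕ.+ b ℕ.≤_) eq (ℕP.m≤m+n (a ℕ.+ b) _))

-- c-beyond with the degree given up to an equation (to be discharged by the ring solver)
c-beyond-by : ∀ {n m} a b → n < m → m ≡ a ℕ.+ b → c n a b ≡ + 0
c-beyond-by a b n<m refl = c-beyond a b n<m

data Excess (m : ℕ) : ℕ → Set where
  within : ∀ e → Excess m (m ℕ.+ e)
  beyond : ∀ {n} → n < m → Excess m n

excess : ∀ m n → Excess m n
excess m n with m ≤? n
... | no m≰n = beyond (ℕP.≰⇒> m≰n)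
... | yes m≤n with ℕP.m≤n⇒∃[o]m+o≡n m≤n
...   | e , refl = within e

excess-weight : ∀ m e → + (m ℕ.+ e) ℤ.- + m ≡ + e
excess-weight m e = trans (ℤP.m-n≡m⊖n (m ℕ.+ e) m)
  (trans (ℤP.⊖-≥ (ℕP.m≤m+n m e)) (cong +_ (ℕP.m+n∸m≡n m e)))

-- In each case split the level is compared with the degree of the
-- coefficient on the left: beyond it everything vanishes, otherwise the homogeneous recurrence
-- applies, with the terms that would need a negative Z-exponent vanishing.

c-0b : ∀ n b → c (suc n) 0 (suc b) ≡ c n 1 b
c-0b n b with excess b n
... | within zero    =
  trans (c-at 0 (suc b) 0 (solveℕ (b ∷ []))) (trans (D-0b0 _ b)
    (sym (c-beyond-by 1 b (ℕP.n<1+n _) (solveℕ (b ∷ [])))))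
... | within (suc e) =
  trans (c-at 0 (suc b) (suc e) (solveℕ (b ∷ e ∷ []))) (trans (D-0b _ b e)
    (sym (c-at 1 b e (solveℕ (b ∷ e ∷ [])))))
... | beyond n<b     =
  trans (c-beyond 0 (suc b) (s≤s n<b)) (sym (c-beyond 1 b (ℕP.m<n⇒m<1+n n<b)))

c-a0 : ∀ n a → c (suc n) (suc a) 0 ≡ c n a 0 ℤ.+ c n a 1
c-a0 n a with excess a n
... | within zero    =
  trans (c-at (suc a) 0 0 (solveℕ (a ∷ []))) (trans (D-a00 _ a) (sym (trans
    (cong₂ ℤ._+_ (c-at a 0 0 (solveℕ (a ∷ [])))
                 (c-beyond-by a 1 (ℕP.n<1+n _) (solveℕ (a ∷ []))))
    (ℤP.+-identityʳ _))))
... | within (suc e) =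
  trans (c-at (suc a) 0 (suc e) (solveℕ (a ∷ e ∷ []))) (trans (D-a0 _ a e) (sym
    (cong₂ ℤ._+_ (c-at a 0 (suc e) (solveℕ (a ∷ e ∷ [])))
                 (c-at a 1 e (solveℕ (a ∷ e ∷ []))))))
... | beyond n<a     =
  trans (c-beyond-by (suc a) 0 (s≤s n<a) (solveℕ (a ∷ []))) (sym
    (cong₂ ℤ._+_ (c-beyond-by a 0 n<a (solveℕ (a ∷ [])))
                 (c-beyond-by a 1 (ℕP.m<n⇒m<1+n n<a) (solveℕ (a ∷ [])))))

c-ab : ∀ n a b → c (suc n) (suc a) (suc b) ≡
       recurrence a b (c n a (suc b)) (c n (2 ℕ.+ a) b) (c n a (2 ℕ.+ b)) (+ n ℤ.- + (a ℕ.+ b)) (c n a b)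
c-ab n a b with excess (a ℕ.+ b) n
... | within zero =
  trans (c-beyond-by (suc a) (suc b) (ℕP.n<1+n _) (solveℕ (a ∷ b ∷ []))) (sym (trans
    (recurrence-cong a b (c-beyond-by a (suc b) (ℕP.n<1+n _) (solveℕ (a ∷ b ∷ [])))
                         (c-beyond-by (2 ℕ.+ a) b (ℕP.m<n⇒m<1+n (ℕP.n<1+n _)) (solveℕ (a ∷ b ∷ [])))
                         (c-beyond-by a (2 ℕ.+ b) (ℕP.m<n⇒m<1+n (ℕP.n<1+n _)) (solveℕ (a ∷ b ∷ [])))
                         (excess-weight (a ℕ.+ b) 0) refl)
    (recurrence-last a b (+ 0) (c (a ℕ.+ b ℕ.+ 0) a b))))
... | within (suc zero) =
  trans (c-at (suc a) (suc b) 0 (solveℕ (a ∷ b ∷ []))) (trans (D-ab0 _ a b) (sym (trans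
    (recurrence-cong a b (c-at a (suc b) 0 (solveℕ (a ∷ b ∷ [])))
                         (c-beyond-by (2 ℕ.+ a) b (ℕP.n<1+n _) (solveℕ (a ∷ b ∷ [])))
                         (c-beyond-by a (2 ℕ.+ b) (ℕP.n<1+n _) (solveℕ (a ∷ b ∷ [])))
                         (excess-weight (a ℕ.+ b) 1) (c-at a b 1 (solveℕ (a ∷ b ∷ []))))
    (recurrence-ends a b (coeff (a ℕ.+ b ℕ.+ 1) a (suc b) 0) (coeff (a ℕ.+ b ℕ.+ 1) a b 1)))))
... | within (suc (suc e)) =
  trans (c-at (suc a) (suc b) (suc e) (solveℕ (a ∷ b ∷ e ∷ []))) (trans (D-ab _ a b e) (sym
    (recurrence-cong a b (c-at a (suc b) (suc e) (solveℕ (a ∷ b ∷ e ∷ [])))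
                         (c-at (2 ℕ.+ a) b e (solveℕ (a ∷ b ∷ e ∷ [])))
                         (c-at a (2 ℕ.+ b) e (solveℕ (a ∷ b ∷ e ∷ [])))
                         (excess-weight (a ℕ.+ b) (2 ℕ.+ e))
                         (c-at a b (2 ℕ.+ e) (solveℕ (a ∷ b ∷ e ∷ []))))))
... | beyond n<ab =
  trans (c-beyond-by (suc a) (suc b) (s≤s (ℕP.m<n⇒m<1+n n<ab)) (solveℕ (a ∷ b ∷ []))) (sym (trans
    (recurrence-cong a b (c-beyond-by a (suc b) (ℕP.m<n⇒m<1+n n<ab) (solveℕ (a ∷ b ∷ [])))
                         (c-beyond-by (2 ℕ.+ a) b (ℕP.m<n⇒m<1+n (ℕP.m<n⇒m<1+n n<ab)) (solveℕ (a ∷ b ∷ [])))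
                         (c-beyond-by a (2 ℕ.+ b) (ℕP.m<n⇒m<1+n (ℕP.m<n⇒m<1+n n<ab)) (solveℕ (a ∷ b ∷ [])))
                         (refl {x = + n ℤ.- + (a ℕ.+ b)}) (c-beyond a b n<ab))
    (trans (recurrence-last a b (+ n ℤ.- + (a ℕ.+ b)) (+ 0)) (ℤP.*-zeroʳ (+ n ℤ.- + (a ℕ.+ b))))))

opaque
  unfolding c coeff

  t-as-c : ∀ n i j → t n i j ≡ c n (2 ℕ.* i ℕ.+ n ℕ.% 2) j
  t-as-c n i j with (2 ℕ.* i ℕ.+ n ℕ.% 2 ℕ.+ j) ≤? n
  ... | yes _   = refl
  ... | no  n≱ = sym (c-beyond _ j (ℕP.≰⇒> n≱))

t-even : ∀ {n} → n ℕ.% 2 ≡ 0 → ∀ i j → t n i j ≡ c n (2 ℕ.* i) j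
t-even {n} r i j = trans (t-as-c n i j)
  (cong (λ a → c n a j) (trans (cong (2 ℕ.* i ℕ.+_) r) (ℕP.+-identityʳ (2 ℕ.* i))))

t-odd : ∀ {n} → n ℕ.% 2 ≡ 1 → ∀ i j → t n i j ≡ c n (suc (2 ℕ.* i)) j
t-odd {n} r i j = trans (t-as-c n i j)
  (cong (λ a → c n a j) (trans (cong (2 ℕ.* i ℕ.+_) r) (ℕP.+-comm (2 ℕ.* i) 1)))

-- A slice is the array of coefficients at one level; oddStep
-- computes the odd coefficients at level n+1 from the even ones at level n, evenStep the even
-- ones from the odd ones.  Both are written in the form the right-hand sides produce.

Slice : Set
Slice = ℕ → ℕ → ℤ

oddStep : Slice → ℕ → ℕ → ℕ → ℤ
oddStep E n i zero    = E i 0 ℤ.+ E i 1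
oddStep E n i (suc j) =
  E i (suc j) ℤ.+ + 2 ℤ.* (+ suc i ℤ.* E (suc i) j ℤ.- + i ℤ.* E i j)
  ℤ.+ (+ suc (suc j) ℤ.* E i (suc (suc j)) ℤ.- + j ℤ.* E i j) ℤ.+ + n ℤ.* E i j

evenStep : Slice → ℕ → ℕ → ℕ → ℤ
evenStep O n zero    zero    = + 0
evenStep O n zero    (suc j) = O 0 j
evenStep O n (suc i) zero    = O i 0 ℤ.+ O i 1
evenStep O n (suc i) (suc j) =
  O i (suc j) ℤ.+ O (suc i) j ℤ.- O i j ℤ.+ + 2 ℤ.* (+ suc i ℤ.* O (suc i) j ℤ.- + i ℤ.* O i j)
  ℤ.+ (+ suc (suc j) ℤ.* O i (suc (suc j)) ℤ.- + j ℤ.* O i j) ℤ.+ + n ℤ.* O i j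

oddStep-cong : ∀ {E E' : Slice} → (∀ i j → E i j ≡ E' i j) → ∀ n i j → oddStep E n i j ≡ oddStep E' n i j
oddStep-cong h n i zero    = cong₂ ℤ._+_ (h i 0) (h i 1)
oddStep-cong h n i (suc j) rewrite h i (suc j) | h (suc i) j | h i j | h i (suc (suc j)) = refl

evenStep-cong : ∀ {O O' : Slice} → (∀ i j → O i j ≡ O' i j) → ∀ n i j → evenStep O n i j ≡ evenStep O' n i j
evenStep-cong h n zero    zero    = refl
evenStep-cong h n zero    (suc j) = h 0 j
evenStep-cong h n (suc i) zero    = cong₂ ℤ._+_ (h i 0) (h i 1)
evenStep-cong h n (suc i) (suc j) rewrite h i (suc j) | h (suc i) j | h i j | h i (suc (suc j)) = refl

oddStep-zero : ∀ n i j → oddStep (λ _ _ → + 0) n i j ≡ + 0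
oddStep-zero n i zero    = refl
oddStep-zero n i (suc j) = lemma (+ i) (+ j) (+ n)
  where
  lemma : ∀ I J N → + 0 ℤ.+ + 2 ℤ.* ((+ 1 ℤ.+ I) ℤ.* + 0 ℤ.- I ℤ.* + 0)
                    ℤ.+ ((+ 2 ℤ.+ J) ℤ.* + 0 ℤ.- J ℤ.* + 0) ℤ.+ N ℤ.* + 0 ≡ + 0
  lemma I J N = solve (I ∷ J ∷ N ∷ [])

evenStep-zero : ∀ n i j → evenStep (λ _ _ → + 0) n i j ≡ + 0
evenStep-zero n zero    zero    = refl
evenStep-zero n zero    (suc j) = refl
evenStep-zero n (suc i) zero    = refl
evenStep-zero n (suc i) (suc j) = lemma (+ i) (+ j) (+ n)
  where
  lemma : ∀ I J N → + 0 ℤ.+ + 0 ℤ.- + 0 ℤ.+ + 2 ℤ.* ((+ 1 ℤ.+ I) ℤ.* + 0 ℤ.- I ℤ.* + 0)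
                    ℤ.+ ((+ 2 ℤ.+ J) ℤ.* + 0 ℤ.- J ℤ.* + 0) ℤ.+ N ℤ.* + 0 ≡ + 0
  lemma I J N = solve (I ∷ J ∷ N ∷ [])

double-suc : ∀ i → 2 ℕ.* suc i ≡ suc (suc (2 ℕ.* i))
double-suc i = ℕP.*-suc 2 i

-- The recurrence at a = 2i in the shape of oddStep: 2i+2 = 2(i+1), and (n-2i-j) x = n x - 2i x - j x.
odd-weights : ∀ i j n u v w x →
  recurrence (2 ℕ.* i) j u v w (+ n ℤ.- + (2 ℕ.* i ℕ.+ j)) x ≡
  u ℤ.+ + 2 ℤ.* (+ suc i ℤ.* v ℤ.- + i ℤ.* x) ℤ.+ (+ suc (suc j) ℤ.* w ℤ.- + j ℤ.* x) ℤ.+ + n ℤ.* x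
odd-weights i j n u v w x =
  lemma (+ i) (+ j) (+ n) u v w x (cong (ℤ._+_ (+ 2)) (ℤP.pos-* 2 i))
        (trans (ℤP.pos-+ (2 ℕ.* i) j) (cong (ℤ._+ + j) (ℤP.pos-* 2 i)))
  where
  lemma : ∀ {A P} I J N u v w x → A ≡ + 2 ℤ.+ + 2 ℤ.* I → P ≡ + 2 ℤ.* I ℤ.+ J →
          u ℤ.+ A ℤ.* v ℤ.+ (+ 2 ℤ.+ J) ℤ.* w ℤ.+ (N ℤ.- P) ℤ.* x ≡
          u ℤ.+ + 2 ℤ.* ((+ 1 ℤ.+ I) ℤ.* v ℤ.- I ℤ.* x) ℤ.+ ((+ 2 ℤ.+ J) ℤ.* w ℤ.- J ℤ.* x) ℤ.+ N ℤ.* x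
  lemma I J N u v w x refl refl = solve (I ∷ J ∷ N ∷ u ∷ v ∷ w ∷ x ∷ [])

-- The recurrence at a = 2i+1 in the shape of evenStep: (2i+3) v = v + 2(i+1) v and
-- (n-2i-1-j) x = n x - x - 2i x - j x.
even-weights : ∀ i j n u v w x →
  recurrence (suc (2 ℕ.* i)) j u v w (+ n ℤ.- + (suc (2 ℕ.* i) ℕ.+ j)) x ≡
  u ℤ.+ v ℤ.- x ℤ.+ + 2 ℤ.* (+ suc i ℤ.* v ℤ.- + i ℤ.* x)
  ℤ.+ (+ suc (suc j) ℤ.* w ℤ.- + j ℤ.* x) ℤ.+ + n ℤ.* x
even-weights i j n u v w x =
  lemma (+ i) (+ j) (+ n) u v w x (cong (ℤ._+_ (+ 3)) (ℤP.pos-* 2 i))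
        (cong (ℤ._+_ (+ 1)) (trans (ℤP.pos-+ (2 ℕ.* i) j) (cong (ℤ._+ + j) (ℤP.pos-* 2 i))))
  where
  lemma : ∀ {A P} I J N u v w x → A ≡ + 3 ℤ.+ + 2 ℤ.* I → P ≡ + 1 ℤ.+ (+ 2 ℤ.* I ℤ.+ J) →
          u ℤ.+ A ℤ.* v ℤ.+ (+ 2 ℤ.+ J) ℤ.* w ℤ.+ (N ℤ.- P) ℤ.* x ≡
          u ℤ.+ v ℤ.- x ℤ.+ + 2 ℤ.* ((+ 1 ℤ.+ I) ℤ.* v ℤ.- I ℤ.* x)
          ℤ.+ ((+ 2 ℤ.+ J) ℤ.* w ℤ.- J ℤ.* x) ℤ.+ N ℤ.* x
  lemma I J N u v w x refl refl = solve (I ∷ J ∷ N ∷ u ∷ v ∷ w ∷ x ∷ [])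

odd-from-even : ∀ n i j → c (suc n) (suc (2 ℕ.* i)) j ≡ oddStep (λ i j → c n (2 ℕ.* i) j) n i j
odd-from-even n i zero    = c-a0 n (2 ℕ.* i)
odd-from-even n i (suc j) = begin
  c (suc n) (suc (2 ℕ.* i)) (suc j)
    ≡⟨ c-ab n (2 ℕ.* i) j ⟩
  recurrence (2 ℕ.* i) j (E i (suc j)) (c n (suc (suc (2 ℕ.* i))) j) (E i (2 ℕ.+ j)) weight (E i j)
    ≡⟨ cong (λ a → recurrence (2 ℕ.* i) j (E i (suc j)) (c n a j) (E i (2 ℕ.+ j)) weight (E i j))
            (sym (double-suc i)) ⟩
  recurrence (2 ℕ.* i) j (E i (suc j)) (E (suc i) j) (E i (2 ℕ.+ j)) weight (E i j)
    ≡⟨ odd-weights i j n (E i (suc j)) (E (suc i) j) (E i (2 ℕ.+ j)) (E i j) ⟩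
  oddStep E n i (suc j) ∎
  where
  open ≡-Reasoning
  E : Slice
  E i j = c n (2 ℕ.* i) j
  weight : ℤ
  weight = + n ℤ.- + (2 ℕ.* i ℕ.+ j)

even-from-odd : ∀ n i j → c (suc n) (2 ℕ.* i) j ≡ evenStep (λ i j → c n (suc (2 ℕ.* i)) j) n i j
even-from-odd n zero    zero    = c-00 n
even-from-odd n zero    (suc j) = c-0b n j
even-from-odd n (suc i) zero    =
  trans (cong (λ a → c (suc n) a 0) (double-suc i)) (c-a0 n (suc (2 ℕ.* i)))
even-from-odd n (suc i) (suc j) = begin
  c (suc n) (2 ℕ.* suc i) (suc j)
    ≡⟨ cong (λ a → c (suc n) a (suc j)) (double-suc i) ⟩
  c (suc n) (suc (suc (2 ℕ.* i))) (suc j)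
    ≡⟨ c-ab n (suc (2 ℕ.* i)) j ⟩
  recurrence (suc (2 ℕ.* i)) j (O i (suc j)) (c n (suc (suc (suc (2 ℕ.* i)))) j) (O i (2 ℕ.+ j)) weight (O i j)
    ≡⟨ cong (λ a → recurrence (suc (2 ℕ.* i)) j (O i (suc j)) (c n (suc a) j) (O i (2 ℕ.+ j)) weight (O i j))
            (sym (double-suc i)) ⟩
  recurrence (suc (2 ℕ.* i)) j (O i (suc j)) (O (suc i) j) (O i (2 ℕ.+ j)) weight (O i j)
    ≡⟨ even-weights i j n (O i (suc j)) (O (suc i) j) (O i (2 ℕ.+ j)) (O i j) ⟩
  evenStep O n (suc i) (suc j) ∎
  where
  open ≡-Reasoning
  O : Slice
  O i j = c n (suc (2 ℕ.* i)) j
  weight : ℤ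
  weight = + n ℤ.- + (suc (2 ℕ.* i) ℕ.+ j)

-- The integer form of both identities at level n+1: the odd part is oddStep of the even part,
-- the even part is evenStep of the odd part (both sides vanish at the wrong parity).
odd-level : ∀ n i j → to (suc n) i j ≡ oddStep (te n) n i j
odd-level n i j with parity n
... | inj₁ ev = begin
  to (suc n) i j                              ≡⟨ keeps ev _ ⟩
  t (suc n) i j                               ≡⟨ t-odd (residue-suc ev) i j ⟩
  c (suc n) (suc (2 ℕ.* i)) j                 ≡⟨ odd-from-even n i j ⟩
  oddStep (λ i j → c n (2 ℕ.* i) j) n i j     ≡⟨ oddStep-cong even-slice n i j ⟨
  oddStep (te n) n i j                        ∎
  where
  open ≡-Reasoning
  even-slice : ∀ i j → te n i j ≡ c n (2 ℕ.* i) j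
  even-slice i j = trans (keeps ev _) (t-even (residue ev) i j)
... | inj₂ od = begin
  to (suc n) i j                   ≡⟨ kills od _ ⟩
  + 0                              ≡⟨ oddStep-zero n i j ⟨
  oddStep (λ _ _ → + 0) n i j      ≡⟨ oddStep-cong (λ i j → kills od _) n i j ⟨
  oddStep (te n) n i j             ∎
  where open ≡-Reasoning

even-level : ∀ n i j → te (suc n) i j ≡ evenStep (to n) n i j
even-level n i j with parity n
... | inj₂ od = begin
  te (suc n) i j                                 ≡⟨ keeps od _ ⟩
  t (suc n) i j                                  ≡⟨ t-even (residue od) i j ⟩
  c (suc n) (2 ℕ.* i) j                          ≡⟨ even-from-odd n i j ⟩
  evenStep (λ i j → c n (suc (2 ℕ.* i)) j) n i j ≡⟨ evenStep-cong odd-slice n i j ⟨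
  evenStep (to n) n i j                          ∎
  where
  open ≡-Reasoning
  odd-slice : ∀ i j → to n i j ≡ c n (suc (2 ℕ.* i)) j
  odd-slice i j = trans (keeps od _) (t-odd (residue-suc od) i j)
... | inj₁ ev = begin
  te (suc n) i j                   ≡⟨ kills ev _ ⟩
  + 0                              ≡⟨ evenStep-zero n i j ⟨
  evenStep (λ _ _ → + 0) n i j     ≡⟨ evenStep-cong (λ i j → kills ev _) n i j ⟨
  evenStep (to n) n i j            ∎
  where open ≡-Reasoning

rhs₁ : FPS3 → FPS3
rhs₁ E = E ⊕ ((+ 2 / 1) · (mulq (∂p E) ⊖ mulq (mulp (∂p E))))
           ⊕ (∂q E ⊖ mulq (mulq (∂q E)))
           ⊕ mulx (mulq (∂x E))

rhs₂ : FPS3 → FPS3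
rhs₂ O = (mulp O ⊕ mulq O ⊖ mulq (mulp O))
           ⊕ ((+ 2 / 1) · (mulp (mulq (∂p O)) ⊖ mulp (mulp (mulq (∂p O)))))
           ⊕ (mulp (∂q O) ⊖ mulp (mulq (mulq (∂q O))))
           ⊕ mulx (mulq (mulp (∂x O)))

rhs₁ᶻ : Coeffs → Coeffs
rhs₁ᶻ E = E ⊕ᶻ (+ 2) ·ᶻ (mulqᶻ (∂pᶻ E) ⊖ᶻ mulqᶻ (mulpᶻ (∂pᶻ E)))
            ⊕ᶻ (∂qᶻ E ⊖ᶻ mulqᶻ (mulqᶻ (∂qᶻ E)))
            ⊕ᶻ mulxᶻ (mulqᶻ (∂xᶻ E))

rhs₂ᶻ : Coeffs → Coeffs
rhs₂ᶻ O = (mulpᶻ O ⊕ᶻ mulqᶻ O ⊖ᶻ mulqᶻ (mulpᶻ O))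
            ⊕ᶻ (+ 2) ·ᶻ (mulpᶻ (mulqᶻ (∂pᶻ O)) ⊖ᶻ mulpᶻ (mulpᶻ (mulqᶻ (∂pᶻ O))))
            ⊕ᶻ (mulpᶻ (∂qᶻ O) ⊖ᶻ mulpᶻ (mulqᶻ (mulqᶻ (∂qᶻ O))))
            ⊕ᶻ mulxᶻ (mulqᶻ (mulpᶻ (∂xᶻ O)))

egf-rhs₁ : ∀ {F f} → F ≐ egf f → rhs₁ F ≐ egf (rhs₁ᶻ f)
egf-rhs₁ hF =
  egf-⊕ (egf-⊕ (egf-⊕ hF (egf-· (+ 2) (egf-⊖ (egf-mulq (egf-∂p hF)) (egf-mulq (egf-mulp (egf-∂p hF))))))
               (egf-⊖ (egf-∂q hF) (egf-mulq (egf-mulq (egf-∂q hF)))))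
        (egf-mulx (egf-mulq (egf-∂x hF)))

egf-rhs₂ : ∀ {F f} → F ≐ egf f → rhs₂ F ≐ egf (rhs₂ᶻ f)
egf-rhs₂ hF =
  egf-⊕ (egf-⊕ (egf-⊕ (egf-⊖ (egf-⊕ (egf-mulp hF) (egf-mulq hF)) (egf-mulq (egf-mulp hF)))
                      (egf-· (+ 2) (egf-⊖ (egf-mulp (egf-mulq (egf-∂p hF)))
                                          (egf-mulp (egf-mulp (egf-mulq (egf-∂p hF)))))))
               (egf-⊖ (egf-mulp (egf-∂q hF)) (egf-mulp (egf-mulq (egf-mulq (egf-∂q hF))))))
        (egf-mulx (egf-mulq (egf-mulp (egf-∂x hF))))

p∂p : ∀ f n i j → mulpᶻ (∂pᶻ f) n i j ≡ + i ℤ.* f n i j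
p∂p f n zero    j = refl
p∂p f n (suc i) j = refl

q∂q : ∀ f n i j → mulqᶻ (∂qᶻ f) n i j ≡ + j ℤ.* f n i j
q∂q f n i zero    = refl
q∂q f n i (suc j) = refl

x∂x : ∀ f n i j → mulxᶻ (∂xᶻ f) n i j ≡ + n ℤ.* f n i j
x∂x f zero    i j = refl
x∂x f (suc n) i j = refl

pq∂p : ∀ f n i j → mulpᶻ (mulqᶻ (∂pᶻ f)) n i (suc j) ≡ + i ℤ.* f n i j
pq∂p f n zero    j = refl
pq∂p f n (suc i) j = refl

pq-zero : ∀ f n i → mulpᶻ (mulqᶻ f) n i 0 ≡ + 0
pq-zero f n zero    = refl
pq-zero f n (suc i) = refl

rhs₁-slice : ∀ f n i j → rhs₁ᶻ f n i j ≡ oddStep (f n) n i j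
rhs₁-slice f n i zero    = lemma (f n i 0) (f n i 1) (+ n)
  where
  lemma : ∀ a b N → a ℤ.+ + 2 ℤ.* (+ 0 ℤ.- + 0) ℤ.+ (+ 1 ℤ.* b ℤ.- + 0) ℤ.+ N ℤ.* + 0 ≡ a ℤ.+ b
  lemma a b N = solve (a ∷ b ∷ N ∷ [])
rhs₁-slice f n i (suc j) rewrite p∂p f n i j | q∂q f n i j | x∂x f n i j = refl

rhs₂-slice : ∀ f n i j → rhs₂ᶻ f n i j ≡ evenStep (f n) n i j
rhs₂-slice f n zero    zero    = lemma (+ n)
  where
  lemma : ∀ N → + 0 ℤ.+ + 0 ℤ.- + 0 ℤ.+ + 2 ℤ.* (+ 0 ℤ.- + 0) ℤ.+ (+ 0 ℤ.- + 0) ℤ.+ N ℤ.* + 0 ≡ + 0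
  lemma N = solve (N ∷ [])
rhs₂-slice f n zero    (suc j) = lemma (f n 0 j) (+ n)
  where
  lemma : ∀ a N → + 0 ℤ.+ a ℤ.- + 0 ℤ.+ + 2 ℤ.* (+ 0 ℤ.- + 0) ℤ.+ (+ 0 ℤ.- + 0) ℤ.+ N ℤ.* + 0 ≡ a
  lemma a N = solve (a ∷ N ∷ [])
rhs₂-slice f n (suc i) zero    rewrite pq-zero (∂pᶻ f) n i = lemma (f n i 0) (f n i 1) (+ n)
  where
  lemma : ∀ a b N → a ℤ.+ + 0 ℤ.- + 0 ℤ.+ + 2 ℤ.* (+ 0 ℤ.- + 0) ℤ.+ (+ 1 ℤ.* b ℤ.- + 0) ℤ.+ N ℤ.* + 0
                    ≡ a ℤ.+ b
  lemma a b N = solve (a ∷ b ∷ N ∷ [])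
rhs₂-slice f n (suc i) (suc j) rewrite pq∂p f n i j | q∂q f n i j | x∂x f n i j = refl

lemma3p10 :
    (∂x TO ≐ TE ⊕ ((+ 2 / 1) · (mulq (∂p TE) ⊖ mulq (mulp (∂p TE))))
                ⊕ (∂q TE ⊖ mulq (mulq (∂q TE)))
                ⊕ mulx (mulq (∂x TE)))
    ×
    (∂x TE ≐ (mulp TO ⊕ mulq TO ⊖ mulq (mulp TO))
                ⊕ ((+ 2 / 1) · (mulp (mulq (∂p TO)) ⊖ mulp (mulp (mulq (∂p TO)))))
                ⊕ (mulp (∂q TO) ⊖ mulp (mulq (mulq (∂q TO))))
                ⊕ mulx (mulq (mulp (∂x TO))))
lemma3p10 = odd-identity , even-identity
  where
  odd-identity : ∂x TO ≐ rhs₁ TE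
  odd-identity n i j =
    trans (egf-∂x TO-egf n i j)
   (trans (egf-cong (λ n i j → trans (odd-level n i j) (sym (rhs₁-slice te n i j))) n i j)
          (sym (egf-rhs₁ TE-egf n i j)))

  even-identity : ∂x TE ≐ rhs₂ TO
  even-identity n i j =
    trans (egf-∂x TE-egf n i j)
   (trans (egf-cong (λ n i j → trans (even-level n i j) (sym (rhs₂-slice to n i j))) n i j)
          (sym (egf-rhs₂ TO-egf n i j)))
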